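{- Let $n\ge5$ be an odd integer and $(\nu_2,\dots,\nu_n)\in\{\pm1\}^{n-1}$. Let $E=\mathbb R^n$, $U=\{e_1+\nu_je_j:2\le j\le n\}$ and $V=\Phi^+_{D_n}$. Then there exists an admissible $(U,V)$-tree.
   Context: $e_1,\dots,e_n$ is the standard basis of $\mathbb R^n$ and $\Phi^+_{D_n}=\{e_i\pm e_j:1\le i<j\le n\}$. A rooted tree $(\mathscr T,O)$ is a finite tree with distinguished vertex $O$; each vertex $v\ne O$ has a parent (the vertex preceding it on the unique path from $O$ to $v$), and $v$ is then a child of its parent; vertices without children are end vertices, forming $|\mathscr T|_{\mathrm{end}}$; a complete family line is the path $(v_0=O,v_1,\dots,v_k)$ from $O$ to an end vertex. For subsets $U,V$ of an abelian group with $U$ finite and $0\notin V$, a $(U,V)$-tree is $(\mathscr T,O,\phi,\psi)$ with $(\mathscr T,O)$ a finite rooted tree and maps $\phi:|\mathscr T|\setminus\{O\}\to U$, $\psi:|\mathscr T|\setminus|\mathscr T|_{\mathrm{end}}\to V$. It is admissible if (1) every non-end vertex $w$ has exactly two children $v,\bar v$, and $\phi(v)-\phi(\bar v)\in\{\psi(w),-\psi(w)\}$; and (2) every complete family line $(v_0,\dots,v_k)$ has $k=|U|-1$, the elements $\phi(v_i)$ ($1\le i\le k$) are pairwise distinct, and the elements $\psi(v_i)$ ($0\le i\le k-1$) are pairwise distinct. -}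

module Defs where

open import Data.Nat using (ℕ; zero; suc; _<_) renaming (_∸_ to _ℕ-∸_; _*_ to _ℕ-*_)
open import Data.Integer as ℤ using (ℤ; 0ℤ; 1ℤ)
import Data.Integer.Properties as ℤP
open import Data.Fin using (Fin; toℕ) renaming (zero to fzero; suc to fsuc)
import Data.Fin as Fin
open import Data.Vec using (Vec; tabulate; zipWith; map)
open import Data.Vec.Properties using (≡-dec)
open import Data.List using (List; []; _∷_; _++_; [_]; length; deduplicate) renaming (tabulate to ltabulate)

open import Data.List.Membership.Propositional using (_∈_)
open import Data.List.Relation.Unary.Unique.Propositional using (Unique)
open import Data.Product using (_×_; _,_; ∃-syntax)
open import Data.Sum using (_⊎_)
open import Data.Sign using (Sign) renaming (+ to s+; - to s-)
open import Relation.Nullary.Decidable using (⌊_⌋)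
open import Relation.Binary.PropositionalEquality using (_≡_)
open import Data.Bool using (if_then_else_)

-- The abelian group ℤⁿ ⊆ ℝⁿ (all vectors involved have integer entries)

Vecℤ : ℕ → Set
Vecℤ n = Vec ℤ n

_⊕_ : ∀ {n} → Vecℤ n → Vecℤ n → Vecℤ n
_⊕_ = zipWith ℤ._+_

⊖_ : ∀ {n} → Vecℤ n → Vecℤ n
⊖_ = map (λ x → ℤ.- x)

_⊝_ : ∀ {n} → Vecℤ n → Vecℤ n → Vecℤ n
u ⊝ v = u ⊕ (⊖ v)

-- standard basis vector e_i (indices are 0-based: e fzero is e₁)
e : ∀ {n} → Fin n → Vecℤ n
e i = tabulate (λ j → if ⌊ i Fin.≟ j ⌋ then 1ℤ else 0ℤ)

signℤ : Sign → ℤ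
signℤ s+ = 1ℤ
signℤ s- = ℤ.- 1ℤ

_·_ : ∀ {n} → ℤ → Vecℤ n → Vecℤ n
c · v = map (c ℤ.*_) v

Φ⁺D : ∀ {n} → Vecℤ n → Set
Φ⁺D {n} v = ∃[ i ] ∃[ j ] (toℕ i < toℕ j × (v ≡ e {n} i ⊕ e j ⊎ v ≡ e {n} i ⊝ e j))

-- U = { e₁ + ν_j e_j : 2 ≤ j ≤ n } for n = suc m; the sign vector
-- (ν₂,…,νₙ) is ν : Fin m → Sign with ν_{j+2} = ν j (0-based j).

Uset : (m : ℕ) → (Fin m → Sign) → List (Vecℤ (suc m))
Uset m ν = ltabulate (λ j → e fzero ⊕ (signℤ (ν j) · e (fsuc j)))

card : ∀ {n} → List (Vecℤ n) → ℕ
card U = length (deduplicate (≡-dec ℤ._≟_) U)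

-- A vertex is either an end vertex, or a
-- vertex carrying its ψ-value together with the (nonempty check is part
-- of admissibility) list of its children, each child carrying its φ-value.
-- The root is the outermost vertex and carries no φ-value.

data LTree (A : Set) : Set where
  end   : LTree A
  inner : A → List (A × LTree A) → LTree A

-- AdmFrom U V φs ψs t: t is the subtree at a
-- vertex v_i of a family line (v_0 = O,…,v_i), where φs = [φ(v_1),…,φ(v_i)]
-- and ψs = [ψ(v_0),…,ψ(v_{i-1})].

data AdmFrom {n} (U : List (Vecℤ n)) (V : Vecℤ n → Set)
     (φs ψs : List (Vecℤ n)) : LTree (Vecℤ n) → Set where
  adm-end : length φs ≡ card U ℕ-∸ 1 → Unique φs → Unique ψs →
            AdmFrom U V φs ψs end
  adm-inner : ∀ {w a b t t̄} → V w → a ∈ U → b ∈ U →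
              (a ⊝ b ≡ w ⊎ a ⊝ b ≡ ⊖ w) →
              AdmFrom U V (φs ++ [ a ]) (ψs ++ [ w ]) t →
              AdmFrom U V (φs ++ [ b ]) (ψs ++ [ w ]) t̄ →
              AdmFrom U V φs ψs (inner w ((a , t) ∷ (b , t̄) ∷ []))

AdmissibleTree : ∀ {n} → List (Vecℤ n) → (Vecℤ n → Set) → LTree (Vecℤ n) → Set
AdmissibleTree U V t = AdmFrom U V [] [] t

OddNat : ℕ → Set
OddNat n = ∃[ k ] n ≡ suc (2 ℕ-* k)

module Submission where

-- The construction works for every m ≥ 1; the
-- hypotheses n ≥ 5 and n odd are only used to exclude m = 0.
--
-- Index U by p < m: u_p = e₁ + ν_p f_p with f_p = e_{p+2}.  The e₁-summand cancels in
-- u_h − u_y = ±(f_h ∓ f_y), and for h < y this residue w_{h,y} is a positive root of D_n.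
-- The subtree tree h (y ∷ ys) has root labelled w_{h,y} and two children, labelled u_h
-- with subtree tree y ys and u_y with subtree tree h ys.  Along a family line the list
-- h ∷ ys holds the indices p for which u_p has not yet occurred as a φ-label; every
-- φ- and ψ-label used so far vanishes at the coordinates f_x of these indices, whereas
-- the new labels u_p and w_{h,y} are nonzero at f_p resp. f_y.  This is the invariant
-- that makes all labels on a family line distinct, and the line has m − 1 steps.

open import Defs
open import Data.Nat using (ℕ; suc; _≤_)
open import Data.Fin using (Fin)
open import Data.Sign using (Sign)
open import Data.Product using (∃-syntax)

open import Data.Nat using (zero; _+_; _∸_; s≤s; _<_)
open import Data.Nat.Properties using (+-assoc; m+n∸n≡m)
open import Data.Fin using (toℕ) renaming (zero to fzero; suc to fsuc)
import Data.Fin as Fin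
open import Data.Fin.Properties using (suc-injective; <⇒≢)
open import Data.Integer as ℤ using (ℤ; 0ℤ; 1ℤ)
open import Data.Integer.Properties using (+-identityˡ; *-identityʳ; *-zeroʳ)
open import Data.Integer.Tactic.RingSolver using (solve-∀)
open import Data.Vec as Vec using (lookup)
open import Data.Vec.Properties using (lookup-zipWith; lookup-map; lookup∘tabulate; tabulate∘lookup; tabulate-cong; ≡-dec)
open import Data.List using (List; []; _∷_; _++_; [_]; length; deduplicate; filter; tabulate)
open import Data.List.Properties using (filter-all; length-tabulate; length-++)
open import Data.List.Relation.Unary.All as All using (All; []; _∷_)
open import Data.List.Relation.Unary.All.Properties using (∷ʳ⁺)
open import Data.List.Relation.Unary.Any using (here)
open import Data.List.Relation.Unary.AllPairs using (AllPairs; []; _∷_)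
open import Data.List.Relation.Unary.AllPairs.Properties using (tabulate⁺-<)
open import Data.List.Relation.Unary.Unique.Propositional using (Unique)
import Data.List.Relation.Unary.Unique.Propositional.Properties as Unique
open import Data.List.Membership.Propositional.Properties using (∈-tabulate⁺)
open import Data.Product using (_,_; _×_; proj₁; proj₂)
open import Data.Sum using (_⊎_; inj₁; inj₂)
open import Data.Sign using () renaming (+ to s+; - to s-)
open import Data.Empty using (⊥-elim)
open import Function using (_∘_; id)
open import Relation.Nullary using (¬?; yes; no; does)
open import Relation.Nullary.Decidable using (dec-true; dec-false; isYes≗does)
open import Data.Bool using (if_then_else_)
open import Relation.Binary.Definitions using (DecidableEquality)
open import Relation.Binary.PropositionalEquality using (_≡_; _≢_; refl; sym; trans; cong; cong₂; module ≡-Reasoning)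

coordinatewise : ∀ {n} {a b : Vecℤ n} → (∀ k → lookup a k ≡ lookup b k) → a ≡ b
coordinatewise {a = a} {b} same = begin
  a                     ≡⟨ tabulate∘lookup a ⟨
  Vec.tabulate (lookup a) ≡⟨ tabulate-cong same ⟩
  Vec.tabulate (lookup b) ≡⟨ tabulate∘lookup b ⟩
  b                     ∎
  where open ≡-Reasoning

module _ {n : ℕ} where

  lookup-⊕ : (a b : Vecℤ n) (k : Fin n) → lookup (a ⊕ b) k ≡ lookup a k ℤ.+ lookup b k
  lookup-⊕ a b k = lookup-zipWith ℤ._+_ k a b

  lookup-⊖ : (a : Vecℤ n) (k : Fin n) → lookup (⊖ a) k ≡ ℤ.- lookup a k
  lookup-⊖ a k = lookup-map k _ a

  lookup-· : (c : ℤ) (a : Vecℤ n) (k : Fin n) → lookup (c · a) k ≡ c ℤ.* lookup a k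
  lookup-· c a k = lookup-map k _ a

  lookup-⊝ : (a b : Vecℤ n) (k : Fin n) → lookup (a ⊝ b) k ≡ lookup a k ℤ.+ ℤ.- lookup b k
  lookup-⊝ a b k = trans (lookup-⊕ a (⊖ b) k) (cong (λ x → lookup a k ℤ.+ x) (lookup-⊖ b k))

  lookup-e : (i k : Fin n) → lookup (e i) k ≡ (if does (i Fin.≟ k) then 1ℤ else 0ℤ)
  lookup-e i k = trans (lookup∘tabulate _ k) (cong (if_then 1ℤ else 0ℤ) (isYes≗does (i Fin.≟ k)))

  e-off : {i k : Fin n} → i ≢ k → lookup (e i) k ≡ 0ℤ
  e-off {i} {k} i≢k = trans (lookup-e i k) (cong (if_then 1ℤ else 0ℤ) (dec-false (i Fin.≟ k) i≢k))

  e-diag : (i : Fin n) → lookup (e i) i ≡ 1ℤ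
  e-diag i = trans (lookup-e i i) (cong (if_then 1ℤ else 0ℤ) (dec-true (i Fin.≟ i) refl))

  ⊕-vanishes : (a b : Vecℤ n) (k : Fin n) → lookup a k ≡ 0ℤ → lookup b k ≡ 0ℤ → lookup (a ⊕ b) k ≡ 0ℤ
  ⊕-vanishes a b k a0 b0 = trans (lookup-⊕ a b k) (cong₂ ℤ._+_ a0 b0)

  ⊝-vanishes : (a b : Vecℤ n) (k : Fin n) → lookup a k ≡ 0ℤ → lookup b k ≡ 0ℤ → lookup (a ⊝ b) k ≡ 0ℤ
  ⊝-vanishes a b k a0 b0 = trans (lookup-⊝ a b k) (cong₂ (λ x y → x ℤ.+ ℤ.- y) a0 b0)

  ⊕-zeroˡ : (a b : Vecℤ n) (k : Fin n) → lookup a k ≡ 0ℤ → lookup (a ⊕ b) k ≡ lookup b k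
  ⊕-zeroˡ a b k a0 = trans (lookup-⊕ a b k) (trans (cong (λ x → x ℤ.+ lookup b k) a0) (+-identityˡ _))

  ⊝-zeroˡ : (a b : Vecℤ n) (k : Fin n) → lookup a k ≡ 0ℤ → lookup (a ⊝ b) k ≡ ℤ.- lookup b k
  ⊝-zeroˡ a b k a0 = trans (lookup-⊝ a b k) (trans (cong (λ x → x ℤ.+ ℤ.- lookup b k) a0) (+-identityˡ _))

  ·-vanishes : (c : ℤ) (a : Vecℤ n) (k : Fin n) → lookup a k ≡ 0ℤ → lookup (c · a) k ≡ 0ℤ
  ·-vanishes c a k a0 = trans (lookup-· c a k) (trans (cong (c ℤ.*_) a0) (*-zeroʳ c))

  ·-unit : (c : ℤ) (a : Vecℤ n) (k : Fin n) → lookup a k ≡ 1ℤ → lookup (c · a) k ≡ c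
  ·-unit c a k a1 = trans (lookup-· c a k) (trans (cong (c ℤ.*_) a1) (*-identityʳ c))

signℤ-nonzero : (σ : Sign) → signℤ σ ≢ 0ℤ
signℤ-nonzero s+ ()
signℤ-nonzero s- ()

-1≢0 : ℤ.- 1ℤ ≢ 0ℤ
-1≢0 ()

1≢0 : 1ℤ ≢ 0ℤ
1≢0 ()

-- What survives of (a + σb) − (a + τc) up to sign: b − c if σ = τ, b + c otherwise.
residue : ∀ {n} → Sign → Sign → Vecℤ n → Vecℤ n → Vecℤ n
residue s+ s+ b c = b ⊝ c
residue s- s- b c = b ⊝ c
residue s+ s- b c = b ⊕ c
residue s- s+ b c = b ⊕ c

private
  cancel-++ : ∀ x y z → (x ℤ.+ 1ℤ ℤ.* y) ℤ.+ ℤ.- (x ℤ.+ 1ℤ ℤ.* z) ≡ y ℤ.+ ℤ.- z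
  cancel-++ = solve-∀

  cancel--- : ∀ x y z → (x ℤ.+ ℤ.- 1ℤ ℤ.* y) ℤ.+ ℤ.- (x ℤ.+ ℤ.- 1ℤ ℤ.* z) ≡ ℤ.- (y ℤ.+ ℤ.- z)
  cancel--- = solve-∀

  cancel-+- : ∀ x y z → (x ℤ.+ 1ℤ ℤ.* y) ℤ.+ ℤ.- (x ℤ.+ ℤ.- 1ℤ ℤ.* z) ≡ y ℤ.+ z
  cancel-+- = solve-∀

  cancel--+ : ∀ x y z → (x ℤ.+ ℤ.- 1ℤ ℤ.* y) ℤ.+ ℤ.- (x ℤ.+ 1ℤ ℤ.* z) ≡ ℤ.- (y ℤ.+ z)
  cancel--+ = solve-∀

module _ {n : ℕ} (a b c : Vecℤ n) where

  private
    expand : ∀ σ τ k → lookup ((a ⊕ (signℤ σ · b)) ⊝ (a ⊕ (signℤ τ · c))) k ≡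
      (lookup a k ℤ.+ signℤ σ ℤ.* lookup b k) ℤ.+ ℤ.- (lookup a k ℤ.+ signℤ τ ℤ.* lookup c k)
    expand σ τ k = trans (lookup-⊝ (a ⊕ (signℤ σ · b)) (a ⊕ (signℤ τ · c)) k)
      (cong₂ (λ x y → x ℤ.+ ℤ.- y) (shifted σ b) (shifted τ c))
      where
      shifted : ∀ ρ v → lookup (a ⊕ (signℤ ρ · v)) k ≡ lookup a k ℤ.+ signℤ ρ ℤ.* lookup v k
      shifted ρ v = trans (lookup-⊕ a (signℤ ρ · v) k) (cong (λ x → lookup a k ℤ.+ x) (lookup-· (signℤ ρ) v k))

    negated-⊝ : ∀ k → lookup (⊖ (b ⊝ c)) k ≡ ℤ.- (lookup b k ℤ.+ ℤ.- lookup c k)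
    negated-⊝ k = trans (lookup-⊖ (b ⊝ c) k) (cong ℤ.-_ (lookup-⊝ b c k))

    negated-⊕ : ∀ k → lookup (⊖ (b ⊕ c)) k ≡ ℤ.- (lookup b k ℤ.+ lookup c k)
    negated-⊕ k = trans (lookup-⊖ (b ⊕ c) k) (cong ℤ.-_ (lookup-⊕ b c k))

  difference-residue : (σ τ : Sign) →
    let d = (a ⊕ (signℤ σ · b)) ⊝ (a ⊕ (signℤ τ · c)) in
    d ≡ residue σ τ b c ⊎ d ≡ ⊖ residue σ τ b c
  difference-residue s+ s+ = inj₁ (coordinatewise λ k →
    trans (expand s+ s+ k) (trans (cancel-++ (lookup a k) (lookup b k) (lookup c k)) (sym (lookup-⊝ b c k))))
  difference-residue s- s- = inj₂ (coordinatewise λ k →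
    trans (expand s- s- k) (trans (cancel--- (lookup a k) (lookup b k) (lookup c k)) (sym (negated-⊝ k))))
  difference-residue s+ s- = inj₁ (coordinatewise λ k →
    trans (expand s+ s- k) (trans (cancel-+- (lookup a k) (lookup b k) (lookup c k)) (sym (lookup-⊕ b c k))))
  difference-residue s- s+ = inj₂ (coordinatewise λ k →
    trans (expand s- s+ k) (trans (cancel--+ (lookup a k) (lookup b k) (lookup c k)) (sym (negated-⊕ k))))

module _ {n : ℕ} {b c : Vecℤ n} {k : Fin n} where

  residue-vanishes : ∀ σ τ → lookup b k ≡ 0ℤ → lookup c k ≡ 0ℤ → lookup (residue σ τ b c) k ≡ 0ℤ
  residue-vanishes s+ s+ = ⊝-vanishes b c k
  residue-vanishes s- s- = ⊝-vanishes b c k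
  residue-vanishes s+ s- = ⊕-vanishes b c k
  residue-vanishes s- s+ = ⊕-vanishes b c k

  residue-nonzero : ∀ σ τ → lookup b k ≡ 0ℤ → lookup c k ≡ 1ℤ → lookup (residue σ τ b c) k ≢ 0ℤ
  residue-nonzero s+ s+ b0 c1 r0 = -1≢0 (trans (sym (trans (⊝-zeroˡ b c k b0) (cong ℤ.-_ c1))) r0)
  residue-nonzero s- s- b0 c1 r0 = -1≢0 (trans (sym (trans (⊝-zeroˡ b c k b0) (cong ℤ.-_ c1))) r0)
  residue-nonzero s+ s- b0 c1 r0 = 1≢0 (trans (sym (trans (⊕-zeroˡ b c k b0) c1)) r0)
  residue-nonzero s- s+ b0 c1 r0 = 1≢0 (trans (sym (trans (⊕-zeroˡ b c k b0) c1)) r0)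

residue-positive : ∀ {n} σ τ {i j : Fin n} → toℕ i < toℕ j → Φ⁺D (residue σ τ (e i) (e j))
residue-positive s+ s+ {i} {j} i<j = i , j , i<j , inj₂ refl
residue-positive s- s- {i} {j} i<j = i , j , i<j , inj₂ refl
residue-positive s+ s- {i} {j} i<j = i , j , i<j , inj₁ refl
residue-positive s- s+ {i} {j} i<j = i , j , i<j , inj₁ refl

u-vec : ∀ {m} → Sign → Fin m → Vecℤ (suc m)
u-vec σ p = e fzero ⊕ (signℤ σ · e (fsuc p))

u-vanishes : ∀ {m} σ {p x : Fin m} → p ≢ x → lookup (u-vec σ p) (fsuc x) ≡ 0ℤ
u-vanishes σ {p} {x} p≢x = ⊕-vanishes (e fzero) (signℤ σ · e (fsuc p)) (fsuc x)
  (e-off {i = fzero} {fsuc x} λ ()) (·-vanishes (signℤ σ) (e (fsuc p)) (fsuc x) (e-off (p≢x ∘ suc-injective)))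

u-nonzero : ∀ {m} σ (p : Fin m) → lookup (u-vec σ p) (fsuc p) ≢ 0ℤ
u-nonzero σ p u0 = signℤ-nonzero σ (trans (sym u-at-p) u0)
  where
  u-at-p : lookup (u-vec σ p) (fsuc p) ≡ signℤ σ
  u-at-p = trans (⊕-zeroˡ (e fzero) (signℤ σ · e (fsuc p)) (fsuc p) (e-off {i = fzero} {fsuc p} λ ()))
                 (·-unit (signℤ σ) (e (fsuc p)) (fsuc p) (e-diag (fsuc p)))

deduplicate-unique : ∀ {A : Set} (_≟_ : DecidableEquality A) {xs : List A} →
  Unique xs → deduplicate _≟_ xs ≡ xs
deduplicate-unique _≟_ [] = refl
deduplicate-unique _≟_ {x ∷ xs} (x∉xs ∷ unique) = cong (x ∷_) (begin
  filter (¬? ∘ (x ≟_)) (deduplicate _≟_ xs) ≡⟨ cong (filter (¬? ∘ (x ≟_))) (deduplicate-unique _≟_ unique) ⟩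
  filter (¬? ∘ (x ≟_)) xs                  ≡⟨ filter-all (¬? ∘ (x ≟_)) x∉xs ⟩
  xs                                       ∎)
  where open ≡-Reasoning

VanishAt : ∀ {n} → Fin n → List (Vecℤ n) → Set
VanishAt k vs = All (λ v → lookup v k ≡ 0ℤ) vs

fresh-snoc : ∀ {n} {k : Fin n} {vs : List (Vecℤ n)} {a : Vecℤ n} →
  Unique vs → VanishAt k vs → lookup a k ≢ 0ℤ → Unique (vs ++ [ a ])
fresh-snoc unique vanish a≠0 =
  Unique.++⁺ unique ([] ∷ []) λ { (a∈vs , here refl) → a≠0 (All.lookup vanish a∈vs) }

module Construction (m : ℕ) (ν : Fin m → Sign) where

  U : List (Vecℤ (suc m))
  U = Uset m ν

  u : Fin m → Vecℤ (suc m)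
  u p = u-vec (ν p) p

  -- The root u_h − u_y up to sign.
  w : Fin m → Fin m → Vecℤ (suc m)
  w h y = residue (ν h) (ν y) (e (fsuc h)) (e (fsuc y))

  -- The u_p are pairwise distinct (u_i is nonzero at f_i, u_j is not), so |U| = m.
  u-injective : ∀ {i j} → u i ≡ u j → i ≡ j
  u-injective {i} {j} ui≡uj with i Fin.≟ j
  ... | yes i≡j = i≡j
  ... | no i≢j = ⊥-elim (u-nonzero (ν i) i
        (trans (cong (λ v → lookup v (fsuc i)) ui≡uj) (u-vanishes (ν j) (i≢j ∘ sym))))

  card-U : card U ≡ m
  card-U = trans (cong length (deduplicate-unique (≡-dec ℤ._≟_) (Unique.tabulate⁺ u-injective)))
                 (length-tabulate u)

  w-nonzero : ∀ {h y} → h ≢ y → lookup (w h y) (fsuc y) ≢ 0ℤ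
  w-nonzero {h} {y} h≢y = residue-nonzero (ν h) (ν y) (e-off (h≢y ∘ suc-injective)) (e-diag (fsuc y))

  w-vanishes : ∀ {h y x} → h Fin.< x → y Fin.< x → lookup (w h y) (fsuc x) ≡ 0ℤ
  w-vanishes {h} {y} h<x y<x =
    residue-vanishes (ν h) (ν y) (e-off (<⇒≢ h<x ∘ suc-injective)) (e-off (<⇒≢ y<x ∘ suc-injective))

  Unused : List (Vecℤ (suc m)) → List (Fin m) → Set
  Unused vs xs = All (λ x → VanishAt (fsuc x) vs) xs

  extend-unused : ∀ {vs a xs} → Unused vs xs → All (λ x → lookup a (fsuc x) ≡ 0ℤ) xs →
    Unused (vs ++ [ a ]) xs
  extend-unused unused a-vanishes = All.zipWith (λ (vanish , a0) → ∷ʳ⁺ vanish a0) (unused , a-vanishes)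

  use : ∀ {φs p q xs} → Unique φs → Unused φs (p ∷ q ∷ xs) → p ≢ q → All (p ≢_) xs →
    Unique (φs ++ [ u p ]) × Unused (φs ++ [ u p ]) (q ∷ xs)
  use {p = p} unique (p-unused ∷ q-unused ∷ xs-unused) p≢q p∉xs =
    fresh-snoc unique p-unused (u-nonzero (ν p) p) ,
    extend-unused (q-unused ∷ xs-unused) (All.map (u-vanishes (ν p)) (p≢q ∷ p∉xs))

  add-root : ∀ {ψs h y ys} → Unique ψs → Unused ψs (y ∷ ys) →
    h Fin.< y → All (h Fin.<_) ys → All (y Fin.<_) ys →
    Unique (ψs ++ [ w h y ]) × Unused (ψs ++ [ w h y ]) ys
  add-root unique (y-unused ∷ ys-unused) h<y h<ys y<ys =
    fresh-snoc unique y-unused (w-nonzero (<⇒≢ h<y)) ,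
    extend-unused ys-unused (All.zipWith (λ (h<x , y<x) → w-vanishes h<x y<x) (h<ys , y<ys))

  tree : Fin m → List (Fin m) → LTree (Vecℤ (suc m))
  tree h [] = end
  tree h (y ∷ ys) = inner (w h y) ((u h , tree y ys) ∷ (u y , tree h ys) ∷ [])

  record Invariant (φs ψs : List (Vecℤ (suc m))) (h : Fin m) (ys : List (Fin m)) : Set where
    field
      sorted    : AllPairs Fin._<_ (h ∷ ys)
      depth     : length φs + suc (length ys) ≡ m
      φs-unique : Unique φs
      ψs-unique : Unique ψs
      φs-unused : Unused φs (h ∷ ys)
      ψs-unused : Unused ψs ys

  step : ∀ {φs ψs h y ys} → Invariant φs ψs h (y ∷ ys) →
    Invariant (φs ++ [ u h ]) (ψs ++ [ w h y ]) y ys × Invariant (φs ++ [ u y ]) (ψs ++ [ w h y ]) h ys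
  step {φs} {ψs} {h} {y} {ys}
       inv@record { sorted = (h<y ∷ h<ys) ∷ (y<ys ∷ sorted) ; φs-unused = h-unused ∷ y-unused ∷ ys-unused } =
      record { sorted = y<ys ∷ sorted ; depth = depth′ ; φs-unique = proj₁ left ; φs-unused = proj₂ left
             ; ψs-unique = proj₁ ψs′ ; ψs-unused = proj₂ ψs′ }
    , record { sorted = h<ys ∷ sorted ; depth = depth′ ; φs-unique = proj₁ right ; φs-unused = proj₂ right
             ; ψs-unique = proj₁ ψs′ ; ψs-unused = proj₂ ψs′ }
    where
    open Invariant inv using (depth; φs-unique; ψs-unique; ψs-unused)

    left : Unique (φs ++ [ u h ]) × Unused (φs ++ [ u h ]) (y ∷ ys)
    left = use φs-unique (h-unused ∷ y-unused ∷ ys-unused) (<⇒≢ h<y) (All.map <⇒≢ h<ys)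

    right : Unique (φs ++ [ u y ]) × Unused (φs ++ [ u y ]) (h ∷ ys)
    right = use φs-unique (y-unused ∷ h-unused ∷ ys-unused) (<⇒≢ h<y ∘ sym) (All.map <⇒≢ y<ys)

    ψs′ : Unique (ψs ++ [ w h y ]) × Unused (ψs ++ [ w h y ]) ys
    ψs′ = add-root ψs-unique ψs-unused h<y h<ys y<ys

    depth′ : ∀ {a} → length (φs ++ [ a ]) + suc (length ys) ≡ m
    depth′ = trans (cong (_+ suc (length ys)) (length-++ φs)) (trans (+-assoc (length φs) 1 _) depth)

  depth-at-end : ∀ {φs : List (Vecℤ (suc m))} → length φs + 1 ≡ m → length φs ≡ card U ∸ 1
  depth-at-end {φs} depth = begin
    length φs           ≡⟨ m+n∸n≡m (length φs) 1 ⟨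
    length φs + 1 ∸ 1   ≡⟨ cong (_∸ 1) depth ⟩
    m ∸ 1               ≡⟨ cong (_∸ 1) card-U ⟨
    card U ∸ 1          ∎
    where open ≡-Reasoning

  admissible : ∀ {φs ψs} h ys → Invariant φs ψs h ys → AdmFrom U Φ⁺D φs ψs (tree h ys)
  admissible {φs} h [] inv = adm-end (depth-at-end {φs} depth) φs-unique ψs-unique
    where open Invariant inv
  admissible h (y ∷ ys) inv@record { sorted = (h<y ∷ _) ∷ _ } =
    adm-inner (residue-positive (ν h) (ν y) (s≤s h<y)) (∈-tabulate⁺ h) (∈-tabulate⁺ y)
      (difference-residue (e fzero) (e (fsuc h)) (e (fsuc y)) (ν h) (ν y))
      (admissible y ys (proj₁ (step inv))) (admissible h ys (proj₂ (step inv)))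

proposition8p5 : (m : ℕ) → 5 ≤ suc m → OddNat (suc m) → (ν : Fin m → Sign) →
    ∃[ t ] AdmissibleTree (Uset m ν) (Φ⁺D {suc m}) t
proposition8p5 zero (s≤s ()) _ _
proposition8p5 (suc k) _ _ ν = tree fzero (tabulate fsuc) , admissible fzero (tabulate fsuc) start
  where
  open Construction (suc k) ν
  start : Invariant [] [] fzero (tabulate fsuc)
  start = record
    { sorted    = tabulate⁺-< id
    ; depth     = cong suc (length-tabulate fsuc)
    ; φs-unique = []
    ; ψs-unique = []
    ; φs-unused = All.universal (λ _ → []) _
    ; ψs-unused = All.universal (λ _ → []) _
    }
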